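{- Let $X$ be a finite set with at least two elements, let $\succsim,\succsim_0,\trianglerighteq\in\mathbb{A}(X)$ satisfy $\succsim\,\rightarrow\,\succsim_0\,\twoheadrightarrow\,\trianglerighteq$, and let $S\subseteq X$. Then the sets $M(S,\succsim)\triangle M(S,\succsim_0)$ and $M(S,\succsim_0)\triangle M(S,\trianglerighteq)$ are disjoint, and their union equals $M(S,\succsim)\triangle M(S,\trianglerighteq)$.
   Context: A binary relation on $X$ is a nonempty subset $R\subseteq X\times X$; write $x\,R\,y$ for $(x,y)\in R$. Its asymmetric part $R^>$: $x\,R^>\,y$ iff $x\,R\,y$ and not $y\,R\,x$; its symmetric part is $R\setminus R^>$. $\mathrm{Inc}(R)$ is the set of $(x,y)\in X\times X$ with neither $x\,R\,y$ nor $y\,R\,x$. $R$ is acyclic if there are no pairwise distinct $z_1,\dots,z_k$ with $z_1\,R^>\,z_2\cdots R^>\,z_k\,R^>\,z_1$. An acyclic order is a reflexive acyclic relation; $\mathbb{A}(X)$ is the set of acyclic orders on $X$. For $\succsim$ (resp. $\trianglerighteq$), $\succ$ (resp. $\vartriangleright$) is its asymmetric part and $\sim$ its symmetric part. For $S\subseteq X$, $M(S,R):=\{x\in S:\text{there is no }y\in S\text{ with }y\,R^>\,x\}$. Perturbations: for $\succsim\in\mathbb{A}(X)$ and $a\neq b$: if neither $a\succ b$ nor $b\succ a$, let $R:=\succsim\cup\{(a,b)\}$ if $(a,b)\in\mathrm{Inc}(\succsim)$ and $R:=\succsim\setminus\{(b,a)\}$ if $a\sim b$; if $R$ is acyclic,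 $\succsim\oplus(a,b):=R$ (otherwise undefined). If $a\succ b$, $\succsim\ominus(a,b):=\succsim\setminus\{(a,b)\}$. We write $\succsim\,\rightarrow\,\succsim_0\,\twoheadrightarrow\,\trianglerighteq$ if either (i) for some $a\succ b$: $\succsim_0=\succsim\ominus(a,b)$, not $a\vartriangleright b$, and $x\succ b$ for every $x\in X$ with $x\vartriangleright b$; or (ii) for some distinct $a,b$ with $(a,b)\in\mathrm{Inc}(\succ)$: $\succsim\oplus(a,b)$ is defined, equals $\succsim_0$, and $a\vartriangleright b$. -}

module Defs where

open import Data.Nat using (ℕ; suc)
open import Data.Fin using (Fin; zero; suc; inject₁; fromℕ; _≟_)
open import Data.Fin.Subset using (Subset; _∈_)
open import Data.Bool using (Bool; T; _∨_; _∧_; not)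
open import Data.Product using (_×_; ∃; ∃-syntax)
open import Data.Sum using (_⊎_)
open import Relation.Nullary using (¬_)
open import Relation.Nullary.Decidable using (⌊_⌋)
open import Relation.Binary.PropositionalEquality using (_≡_; _≢_)
open import Function.Definitions using (Injective)

-- A finite set X is represented as Fin n.  A (decidable) binary relation on
-- X is a Bool-valued function; x R y means T (R x y).
BRel : ℕ → Set
BRel n = Fin n → Fin n → Bool

module _ {n : ℕ} where

  _⟨_⟩_ : Fin n → BRel n → Fin n → Set
  x ⟨ R ⟩ y = T (R x y)

  _⟨_⟩>_ : Fin n → BRel n → Fin n → Set
  x ⟨ R ⟩> y = x ⟨ R ⟩ y × ¬ (y ⟨ R ⟩ x)

  _⟨_⟩∼_ : Fin n → BRel n → Fin n → Set
  x ⟨ R ⟩∼ y = x ⟨ R ⟩ y × y ⟨ R ⟩ x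

  Inc : BRel n → Fin n → Fin n → Set
  Inc R x y = ¬ (x ⟨ R ⟩ y) × ¬ (y ⟨ R ⟩ x)

  IncAsym : BRel n → Fin n → Fin n → Set
  IncAsym R x y = ¬ (x ⟨ R ⟩> y) × ¬ (y ⟨ R ⟩> x)

  _≐_ : BRel n → BRel n → Set
  R ≐ Q = ∀ x y → R x y ≡ Q x y

  Nonempty : BRel n → Set
  Nonempty R = ∃[ x ] ∃[ y ] x ⟨ R ⟩ y

  Reflexive : BRel n → Set
  Reflexive R = ∀ x → x ⟨ R ⟩ x

  Acyclic : BRel n → Set
  Acyclic R = ∀ (k : ℕ) (z : Fin (suc k) → Fin n) → Injective _≡_ _≡_ z →
    ¬ ((∀ (i : Fin k) → z (inject₁ i) ⟨ R ⟩> z (suc i)) × (z (fromℕ k) ⟨ R ⟩> z zero))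

  IsAcyclicOrder : BRel n → Set
  IsAcyclicOrder R = Nonempty R × Reflexive R × Acyclic R

  addPair : BRel n → Fin n → Fin n → BRel n
  addPair R a b x y = R x y ∨ (⌊ x ≟ a ⌋ ∧ ⌊ y ≟ b ⌋)

  removePair : BRel n → Fin n → Fin n → BRel n
  removePair R a b x y = R x y ∧ not (⌊ x ≟ a ⌋ ∧ ⌊ y ≟ b ⌋)

  -- "≿ ⊕ (a,b) is defined and equals Q"
  OPlusIs : BRel n → Fin n → Fin n → BRel n → Set
  OPlusIs R a b Q =
    a ≢ b × ¬ (a ⟨ R ⟩> b) × ¬ (b ⟨ R ⟩> a) ×
    ((Inc R a b × Q ≐ addPair R a b) ⊎ (a ⟨ R ⟩∼ b × Q ≐ removePair R b a)) ×
    Acyclic Q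

  -- "≿ ⊖ (a,b) is defined and equals Q"
  OMinusIs : BRel n → Fin n → Fin n → BRel n → Set
  OMinusIs R a b Q = a ⟨ R ⟩> b × Q ≐ removePair R a b

  -- ≿ → ≿₀ ↠ ⊵
  Step : BRel n → BRel n → BRel n → Set
  Step R R₀ D =
    (∃[ a ] ∃[ b ] (OMinusIs R a b R₀ × ¬ (a ⟨ D ⟩> b) ×
                    (∀ x → x ⟨ D ⟩> b → x ⟨ R ⟩> b)))
    ⊎
    (∃[ a ] ∃[ b ] (a ≢ b × IncAsym R a b × OPlusIs R a b R₀ × a ⟨ D ⟩> b))

  InM : Subset n → BRel n → Fin n → Set
  InM S R x = x ∈ S × (∀ y → y ∈ S → ¬ (y ⟨ R ⟩> x))

  SymDiff : (Fin n → Set) → (Fin n → Set) → Fin n → Set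
  SymDiff A B x = (A x × ¬ B x) ⊎ (B x × ¬ A x)

-- For any sets with A ∩ B ⊆ C ⊆ A ∪ B, the differences A △ C and C △ B partition A △ B,
-- so it suffices that M(S,≿) ∩ M(S,⊵) ⊆ M(S,≿₀) ⊆ M(S,≿) ∪ M(S,⊵).  A perturbation
-- changes a relation by one pair, so the strict parts of ≿ and ≿₀ are nested and differ
-- by at most the comparison a over b; the conditions on ⊵ in the definition of ↠ are
-- exactly what neutralise that comparison.
module Submission where

open import Defs
open import Data.Nat using (ℕ; _≤_)
open import Data.Fin using (Fin; _≟_)
open import Data.Fin.Subset using (Subset; _∈_)
open import Data.Fin.Subset.Properties using (_∈?_)
open import Data.Fin.Properties using (all?)
open import Data.Bool using (T; _∧_)
open import Data.Bool.Properties using (T?; T-∧; T-∨)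
open import Data.Product as Product using (_×_; _,_; proj₁; proj₂)
open import Data.Sum as Sum using (_⊎_; inj₁; inj₂; [_,_]′)
open import Data.Empty using (⊥-elim)
open import Function using (id; _∘_)
open import Function.Bundles using (_⇔_; mk⇔; Equivalence)
open import Level using (0ℓ)
open import Relation.Nullary using (¬_; yes; no)
open import Relation.Nullary.Decidable using (⌊_⌋; toWitness; _×-dec_; _→-dec_; ¬?)
open import Relation.Binary.Core using (Rel; _⇒_)
open import Relation.Binary.PropositionalEquality using (_≡_; _≢_; refl; subst; sym)
open import Relation.Unary using (Pred; Decidable; _⊆_; _∩_; _∪_)

module _ {n : ℕ} where

  Between : (A C B : Pred (Fin n) 0ℓ) → Set
  Between A C B = (A ∩ B ⊆ C) × (C ⊆ A ∪ B)

  Between-symDiff-disjoint : {A C B : Pred (Fin n) 0ℓ} → Between A C B →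
                             ∀ x → ¬ (SymDiff A C x × SymDiff C B x)
  Between-symDiff-disjoint (A∩B⊆C , C⊆A∪B) x (inj₁ (a , ¬c) , inj₂ (b , _))  = ¬c (A∩B⊆C (a , b))
  Between-symDiff-disjoint (A∩B⊆C , C⊆A∪B) x (inj₂ (c , ¬a) , inj₁ (_ , ¬b)) = [ ¬a , ¬b ]′ (C⊆A∪B c)
  Between-symDiff-disjoint (A∩B⊆C , C⊆A∪B) x (inj₁ (_ , ¬c) , inj₁ (c , _))  = ¬c c
  Between-symDiff-disjoint (A∩B⊆C , C⊆A∪B) x (inj₂ (c , _)  , inj₂ (_ , ¬c)) = ¬c c

  Between-symDiff-∪ : {A C B : Pred (Fin n) 0ℓ} → Decidable C → Between A C B →
                      ∀ x → (SymDiff A C x ⊎ SymDiff C B x) ⇔ SymDiff A B x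
  Between-symDiff-∪ {A} {C} {B} C? (A∩B⊆C , C⊆A∪B) x = mk⇔ to from
    where
    to : SymDiff A C x ⊎ SymDiff C B x → SymDiff A B x
    to (inj₁ (inj₁ (a , ¬c))) = inj₁ (a , λ b → ¬c (A∩B⊆C (a , b)))
    to (inj₁ (inj₂ (c , ¬a))) = inj₂ ([ (λ a → ⊥-elim (¬a a)) , id ]′ (C⊆A∪B c) , ¬a)
    to (inj₂ (inj₁ (c , ¬b))) = inj₁ ([ id , (λ b → ⊥-elim (¬b b)) ]′ (C⊆A∪B c) , ¬b)
    to (inj₂ (inj₂ (b , ¬c))) = inj₂ (b , λ a → ¬c (A∩B⊆C (a , b)))

    from : SymDiff A B x → SymDiff A C x ⊎ SymDiff C B x
    from (inj₁ (a , ¬b)) with C? x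
    ... | yes c = inj₂ (inj₁ (c , ¬b))
    ... | no ¬c = inj₁ (inj₁ (a , ¬c))
    from (inj₂ (b , ¬a)) with C? x
    ... | yes c = inj₁ (inj₂ (c , ¬a))
    ... | no ¬c = inj₂ (inj₂ (b , ¬c))

  _∪⟨_,_⟩ : Rel (Fin n) 0ℓ → Fin n → Fin n → Rel (Fin n) 0ℓ
  (P ∪⟨ c , d ⟩) x y = (x ≡ c × y ≡ d) ⊎ P x y

  record PairExtension (small large : BRel n) (c d : Fin n) : Set where
    field
      small⇒large     : _⟨ small ⟩_ ⇒ _⟨ large ⟩_
      large⇒small∪cd  : _⟨ large ⟩_ ⇒ (_⟨ small ⟩_ ∪⟨ c , d ⟩)

  module _ {small large : BRel n} {c d : Fin n} (E : PairExtension small large c d) where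
    open PairExtension E

    small>⇒large> : ¬ (d ⟨ large ⟩ c) → _⟨ small ⟩>_ ⇒ _⟨ large ⟩>_
    small>⇒large> ¬dc (ySx , ¬xSy) =
      small⇒large ySx , λ xLy → [ (λ { (refl , refl) → ¬dc (small⇒large ySx) }) , ¬xSy ]′
                                 (large⇒small∪cd xLy)

    large>⇒small> : d ⟨ large ⟩ c → _⟨ large ⟩>_ ⇒ _⟨ small ⟩>_
    large>⇒small> dc (yLx , ¬xLy) =
      [ (λ { (refl , refl) → ⊥-elim (¬xLy dc) }) , id ]′ (large⇒small∪cd yLx) ,
      λ xSy → ¬xLy (small⇒large xSy)

    large>⇒small>∪cd : _⟨ large ⟩>_ ⇒ (_⟨ small ⟩>_ ∪⟨ c , d ⟩)
    large>⇒small>∪cd (yLx , ¬xLy) with large⇒small∪cd yLx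
    ... | inj₁ cd  = inj₁ cd
    ... | inj₂ ySx = inj₂ (ySx , λ xSy → ¬xLy (small⇒large xSy))

    small>⇒large>∪dc : _⟨ small ⟩>_ ⇒ (_⟨ large ⟩>_ ∪⟨ d , c ⟩)
    small>⇒large>∪dc {y} {x} (ySx , ¬xSy) with T? (large x y)
    ... | no ¬xLy = inj₂ (small⇒large ySx , ¬xLy)
    ... | yes xLy = [ (λ { (refl , refl) → inj₁ (refl , refl) }) , (λ xSy → ⊥-elim (¬xSy xSy)) ]′
                      (large⇒small∪cd xLy)

  ≐⇒ : {P Q : BRel n} → P ≐ Q → _⟨ P ⟩_ ⇒ _⟨ Q ⟩_
  ≐⇒ P≐Q {x} {y} = subst T (P≐Q x y)

  ≐⇐ : {P Q : BRel n} → P ≐ Q → _⟨ Q ⟩_ ⇒ _⟨ P ⟩_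
  ≐⇐ P≐Q {x} {y} = subst T (sym (P≐Q x y))

  isPair : {a b x y : Fin n} → T (⌊ x ≟ a ⌋ ∧ ⌊ y ≟ b ⌋) → x ≡ a × y ≡ b
  isPair {a} {b} {x} {y} t =
    Product.map toWitness toWitness (Equivalence.to (T-∧ {⌊ x ≟ a ⌋} {⌊ y ≟ b ⌋}) t)

  removePair-⊇ : (R : BRel n) (a b : Fin n) → _⟨ R ⟩_ ⇒ (_⟨ removePair R a b ⟩_ ∪⟨ a , b ⟩)
  removePair-⊇ R a b {x} {y} xRy with x ≟ a | y ≟ b
  ... | yes x≡a | yes y≡b = inj₁ (x≡a , y≡b)
  ... | yes _   | no _    = inj₂ (Equivalence.from T-∧ (xRy , _))
  ... | no _    | _       = inj₂ (Equivalence.from T-∧ (xRy , _))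

  removePair-extension : {R Q : BRel n} {a b : Fin n} → Q ≐ removePair R a b → PairExtension Q R a b
  removePair-extension {R} {Q} {a} {b} Q≐R-ab = record
    { small⇒large    = λ xQy → proj₁ (Equivalence.to T-∧ (≐⇒ Q≐R-ab xQy))
    ; large⇒small∪cd = λ xRy → Sum.map₂ (≐⇐ Q≐R-ab) (removePair-⊇ R a b xRy)
    }

  addPair-extension : {R Q : BRel n} {a b : Fin n} → Q ≐ addPair R a b → PairExtension R Q a b
  addPair-extension Q≐R+ab = record
    { small⇒large    = λ xRy → ≐⇐ Q≐R+ab (Equivalence.from T-∨ (inj₁ xRy))
    ; large⇒small∪cd = λ xQy → Sum.swap (Sum.map₂ isPair (Equivalence.to T-∨ (≐⇒ Q≐R+ab xQy)))
    }

  InM? : (S : Subset n) (R : BRel n) → Decidable (InM S R)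
  InM? S R x = (x ∈? S) ×-dec all? λ y →
    (y ∈? S) →-dec ¬? (T? (R y x) ×-dec ¬? (T? (R x y)))

  InM-mono : {S : Subset n} {P Q : BRel n} {x : Fin n} →
             (∀ {y} → y ∈ S → y ⟨ P ⟩> x → y ⟨ Q ⟩> x) → InM S Q x → InM S P x
  InM-mono P⇒Q (x∈S , maxQ) = x∈S , λ y y∈S yPx → maxQ y y∈S (P⇒Q y∈S yPx)

  InM-antitone : {S : Subset n} {P Q : BRel n} →
                 _⟨ P ⟩>_ ⇒ _⟨ Q ⟩>_ → InM S Q ⊆ InM S P
  InM-antitone {S} {P} {Q} P⇒Q = InM-mono {S} {P} {Q} λ _ → P⇒Q

  InM-antitone-except : {S : Subset n} {P Q : BRel n} {a b x : Fin n} →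
                        _⟨ P ⟩>_ ⇒ (_⟨ Q ⟩>_ ∪⟨ a , b ⟩) → (a ∈ S → x ≢ b) →
                        InM S Q x → InM S P x
  InM-antitone-except {S} {P} {Q} P⇒Q∪ab a∈S⇒x≢b = InM-mono {S} {P} {Q} λ y∈S yPx →
    [ (λ { (refl , x≡b) → ⊥-elim (a∈S⇒x≢b y∈S x≡b) }) , id ]′ (P⇒Q∪ab yPx)

  module _ {S : Subset n} {R R₀ D : BRel n} {a b : Fin n} where

    InM-between-⊖ : _⟨ R₀ ⟩>_ ⇒ _⟨ R ⟩>_ → _⟨ R ⟩>_ ⇒ (_⟨ R₀ ⟩>_ ∪⟨ a , b ⟩) →
                    ¬ (a ⟨ D ⟩> b) → (∀ x → x ⟨ D ⟩> b → x ⟨ R ⟩> b) →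
                    Between (InM S R) (InM S R₀) (InM S D)
    InM-between-⊖ R₀⇒R R⇒R₀∪ab ¬aDb D⇒R-at-b =
      InM-antitone {S} {R₀} {R} R₀⇒R ∘ proj₁ , maximal
      where
      maximal : InM S R₀ ⊆ InM S R ∪ InM S D
      maximal {x} inR₀ with x ≟ b
      ... | no x≢b  = inj₁ (InM-antitone-except {S} {R} {R₀} R⇒R₀∪ab (λ _ → x≢b) inR₀)
      ... | yes refl = inj₂ (InM-mono {S} {D} {R₀} (λ {y} _ yDb →
              [ (λ { (refl , _) → ⊥-elim (¬aDb yDb) }) , id ]′ (R⇒R₀∪ab (D⇒R-at-b y yDb))) inR₀)

    InM-between-⊕ : _⟨ R ⟩>_ ⇒ _⟨ R₀ ⟩>_ → _⟨ R₀ ⟩>_ ⇒ (_⟨ R ⟩>_ ∪⟨ a , b ⟩) →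
                    a ⟨ D ⟩> b → Between (InM S R) (InM S R₀) (InM S D)
    InM-between-⊕ R⇒R₀ R₀⇒R∪ab aDb =
      (λ { (inR , (_ , maxD)) →
           InM-antitone-except {S} {R₀} {R} R₀⇒R∪ab (λ { a∈S refl → maxD a a∈S aDb }) inR }) ,
      inj₁ ∘ InM-antitone {S} {R} {R₀} R⇒R₀

  Step-between : {S : Subset n} {R R₀ D : BRel n} → Step R R₀ D →
                 Between (InM S R) (InM S R₀) (InM S D)
  Step-between (inj₁ (a , b , (aRb , R₀≐R-ab) , ¬aDb , D⇒R-at-b)) =
    InM-between-⊖ (small>⇒large> E (proj₂ aRb)) (large>⇒small>∪cd E)
                  ¬aDb D⇒R-at-b
    where E = removePair-extension R₀≐R-ab
  Step-between {R₀ = R₀} (inj₂ (a , b , a≢b , _ , (_ , _ , _ , inj₁ (inc , R₀≐R+ab) , _) , aDb)) =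
    InM-between-⊕ (small>⇒large> E ¬bR₀a) (large>⇒small>∪cd E) aDb
    where
    E = addPair-extension R₀≐R+ab
    ¬bR₀a : ¬ (b ⟨ R₀ ⟩ a)
    ¬bR₀a bR₀a = [ (λ { (b≡a , _) → a≢b (sym b≡a) }) , proj₂ inc ]′
                   (PairExtension.large⇒small∪cd E bR₀a)
  Step-between (inj₂ (a , b , _ , _ , (_ , _ , _ , inj₂ (a∼b , R₀≐R-ba) , _) , aDb)) =
    InM-between-⊕ (large>⇒small> E (proj₁ a∼b)) (small>⇒large>∪dc E) aDb
    where E = removePair-extension R₀≐R-ba

lemma3p3 : (n : ℕ) → 2 ≤ n → (R R₀ D : BRel n) →
    IsAcyclicOrder R → IsAcyclicOrder R₀ → IsAcyclicOrder D →
    Step R R₀ D → (S : Subset n) →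
    (∀ x → ¬ (SymDiff (InM S R) (InM S R₀) x × SymDiff (InM S R₀) (InM S D) x)) ×
    (∀ x → (SymDiff (InM S R) (InM S R₀) x ⊎ SymDiff (InM S R₀) (InM S D) x)
    ⇔ SymDiff (InM S R) (InM S D) x)
lemma3p3 n _ R R₀ D _ _ _ step S =
  Between-symDiff-disjoint between , Between-symDiff-∪ (InM? S R₀) between
  where
  between : Between (InM S R) (InM S R₀) (InM S D)
  between = Step-between step
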